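{- Let $(P,\le,0,1)$ be a complemented poset of finite height. Then the following holds: (i) $\circ$ and $\odot$ are monotone from the left, (ii) $\to$ and $\hookrightarrow$ are monotone from the right.
   Context: $(P,\le,0,1)$ is a bounded poset with $0\ne1$, complemented (every element has a complement $b$ with $a\vee b=1$, $a\wedge b=0$), of finite length/height (no infinite chains). $x^+$ denotes the set of all complements of $x$. $\mathrm{Max}\,A$, $\mathrm{Min}\,A$ are the sets of maximal, minimal elements of $A$; $L(A)$, $U(A)$ the sets of lower, upper bounds, with $L(A,B):=L(A\cup B)$ etc. Define $a\circ b:=\mathrm{Max}\,L(a,b)$, $a\to b:=\mathrm{Min}\,U(a^+,b)$, $a\odot b:=\mathrm{Max}\,L\big(b,U(a,b^+)\big)$, $a\hookrightarrow b:=\mathrm{Min}\,U\big(a^+,L(a,b)\big)$. For sets, $A\le_1B$ means every $x\in A$ has some $y\in B$ with $x\le y$; $A\le_2B$ means every $y\in B$ has some $x\in A$ with $x\le y$. A binary operator $*$ is monotone from the left if $x\le y$ implies $x*z\le_1y*z$, and monotone from the right if $x\le y$ implies $z*x\le_2z*y$. -}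

module Defs where

open import Level using (0ℓ)
open import Data.Nat using (ℕ)
open import Data.Product using (Σ; ∃; _×_; _,_)
open import Data.Sum using (_⊎_)
open import Relation.Nullary using (¬_)
open import Relation.Unary using (Pred; _∪_; ｛_｝)
open import Relation.Binary using (IsPartialOrder)
open import Relation.Binary.PropositionalEquality using (_≡_)
open import Function.Definitions using (Injective)

record BoundedPoset : Set₁ where
  field
    Carrier        : Set
    _≤_            : Carrier → Carrier → Set
    isPartialOrder : IsPartialOrder _≡_ _≤_
    𝟘 𝟙            : Carrier
    𝟘-min          : ∀ x → 𝟘 ≤ x
    𝟙-max          : ∀ x → x ≤ 𝟙
    𝟘≢𝟙            : ¬ (𝟘 ≡ 𝟙)

module _ (P : BoundedPoset) where
  open BoundedPoset P

  Subset : Set₁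
  Subset = Pred Carrier 0ℓ

  L : Subset → Subset
  L A z = ∀ w → A w → z ≤ w

  U : Subset → Subset
  U A z = ∀ w → A w → w ≤ z

  Max : Subset → Subset
  Max A x = A x × (∀ y → A y → x ≤ y → y ≡ x)

  Min : Subset → Subset
  Min A x = A x × (∀ y → A y → y ≤ x → y ≡ x)

  -- b is a complement of a: a ∨ b = 1 and a ∧ b = 0, i.e. the only
  -- upper bound of {a,b} is 1 and the only lower bound of {a,b} is 0.
  IsComplement : Carrier → Carrier → Set
  IsComplement a b = (∀ z → U (｛ a ｝ ∪ ｛ b ｝) z → z ≡ 𝟙)
                   × (∀ z → L (｛ a ｝ ∪ ｛ b ｝) z → z ≡ 𝟘)

  _⁺ : Carrier → Subset
  (a ⁺) b = IsComplement a b

  Complemented : Set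
  Complemented = ∀ a → ∃ λ b → IsComplement a b

  -- finite length/height: no infinite chains (an infinite chain is
  -- represented by an injective sequence whose elements are pairwise comparable)
  NoInfiniteChain : Set
  NoInfiniteChain = ¬ (Σ (ℕ → Carrier) λ f →
                        Injective _≡_ _≡_ f × (∀ i j → f i ≤ f j ⊎ f j ≤ f i))

  _∘ₚ_ : Carrier → Carrier → Subset
  a ∘ₚ b = Max (L (｛ a ｝ ∪ ｛ b ｝))

  _⇒ₚ_ : Carrier → Carrier → Subset
  a ⇒ₚ b = Min (U ((a ⁺) ∪ ｛ b ｝))

  _⊙ₚ_ : Carrier → Carrier → Subset
  a ⊙ₚ b = Max (L (｛ b ｝ ∪ U (｛ a ｝ ∪ (b ⁺))))

  _↪ₚ_ : Carrier → Carrier → Subset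
  a ↪ₚ b = Min (U ((a ⁺) ∪ L (｛ a ｝ ∪ ｛ b ｝)))

  _≤₁_ : Subset → Subset → Set
  A ≤₁ B = ∀ x → A x → ∃ λ y → B y × x ≤ y

  _≤₂_ : Subset → Subset → Set
  A ≤₂ B = ∀ y → B y → ∃ λ x → A x × x ≤ y

  MonotoneLeft : (Carrier → Carrier → Subset) → Set
  MonotoneLeft _*_ = ∀ x y z → x ≤ y → (x * z) ≤₁ (y * z)

  MonotoneRight : (Carrier → Carrier → Subset) → Set
  MonotoneRight _*_ = ∀ x y z → x ≤ y → (z * x) ≤₂ (z * y)

-- Each of the four operators is Max or Min of a set built from L and U. When x ≤ y the
-- relevant set for x is contained in (∘, ⊙) or contains (→, ↪) the one for y, since L and U
-- are antitone with respect to ≤₂ and ≤₁.  Monotonicity then follows because, classically and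
-- in the absence of infinite chains, every element of a subset lies below a maximal and above
-- a minimal element of it: otherwise one could climb forever along a strictly ascending chain.
module Submission where

open import Defs
open import Level using (0ℓ)
open import Data.Product using (_×_; Σ; ∃; _,_; proj₁; proj₂)
open import Data.Sum using (_⊎_; inj₁; inj₂; swap)
open import Data.Empty using (⊥-elim)
open import Data.Nat as ℕ using (ℕ; zero; suc; _≤′_; ≤′-reflexive; ≤′-step)
open import Data.Nat.Properties using (≤⇒≤′; ≤-total; <-cmp)
open import Function using (flip)
open import Function.Definitions using (Injective)
open import Relation.Nullary using (¬_)
open import Relation.Binary using (IsPartialOrder; tri<; tri≈; tri>)
open import Relation.Binary.PropositionalEquality using (_≡_; _≢_; refl; sym; subst; ≢-sym)
import Relation.Binary.Construct.Flip.EqAndOrd as Flip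
open import Relation.Unary using (_⊆_; _∪_; ｛_｝)
open import Axiom.ExcludedMiddle using (ExcludedMiddle)
open import Axiom.DoubleNegationElimination using (em⇒dne)

dual : BoundedPoset → BoundedPoset
dual P = record
  { Carrier        = Carrier
  ; _≤_            = flip _≤_
  ; isPartialOrder = Flip.isPartialOrder isPartialOrder
  ; 𝟘              = 𝟙
  ; 𝟙              = 𝟘
  ; 𝟘-min          = 𝟙-max
  ; 𝟙-max          = 𝟘-min
  ; 𝟘≢𝟙            = ≢-sym 𝟘≢𝟙
  }
  where open BoundedPoset P

dual-noInfiniteChain : ∀ P → NoInfiniteChain P → NoInfiniteChain (dual P)
dual-noInfiniteChain P noChain (f , f-injective , f-comparable) =
  noChain (f , f-injective , λ i j → swap (f-comparable i j))

module _ (P : BoundedPoset) where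
  open BoundedPoset P
  open IsPartialOrder isPartialOrder using ()
    renaming (refl to ≤-refl; trans to ≤-trans; antisym to ≤-antisym)

  private variable
    A B : Subset P
    x : Carrier

  module _ {f : ℕ → Carrier} (f-ascending : ∀ n → f n ≤ f (suc n)) where

    ascending-mono : ∀ {i j} → i ≤′ j → f i ≤ f j
    ascending-mono (≤′-reflexive refl) = ≤-refl
    ascending-mono (≤′-step i≤′j)      = ≤-trans (ascending-mono i≤′j) (f-ascending _)

    ascending-comparable : ∀ i j → f i ≤ f j ⊎ f j ≤ f i
    ascending-comparable i j with ≤-total i j
    ... | inj₁ i≤j = inj₁ (ascending-mono (≤⇒≤′ i≤j))
    ... | inj₂ j≤i = inj₂ (ascending-mono (≤⇒≤′ j≤i))

    module _ (f-strict : ∀ n → f n ≢ f (suc n)) where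

      strictlyAscending-noReturn : ∀ {i j} → i ℕ.< j → f i ≢ f j
      strictlyAscending-noReturn {i} i<j fi≡fj = f-strict i (≤-antisym (f-ascending i)
        (subst (f (suc i) ≤_) (sym fi≡fj) (ascending-mono (≤⇒≤′ i<j))))

      strictlyAscending-injective : Injective _≡_ _≡_ f
      strictlyAscending-injective {i} {j} fi≡fj with <-cmp i j
      ... | tri< i<j _ _ = ⊥-elim (strictlyAscending-noReturn i<j fi≡fj)
      ... | tri≈ _ i≡j _ = i≡j
      ... | tri> _ _ j<i = ⊥-elim (strictlyAscending-noReturn j<i (sym fi≡fj))

  Stranded : Subset P → Carrier → Set
  Stranded A x = A x × ¬ (∃ λ m → Max P A m × x ≤ m)

  module _ (lem : ExcludedMiddle 0ℓ) where

    stranded-ascend : Stranded A x → ∃ λ y → Stranded A y × x ≤ y × x ≢ y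
    stranded-ascend {A} {x} (x∈A , x-stranded) =
      em⇒dne lem λ no-ascent → x-stranded (x , (x∈A , x-maximal no-ascent) , ≤-refl)
      where
      x-maximal : ¬ (∃ λ y → Stranded A y × x ≤ y × x ≢ y) → ∀ y → A y → x ≤ y → y ≡ x
      x-maximal no-ascent y y∈A x≤y = em⇒dne lem λ y≢x → no-ascent
        (y , (y∈A , λ (m , m-max , y≤m) → x-stranded (m , m-max , ≤-trans x≤y y≤m)) , x≤y , ≢-sym y≢x)

    module _ (noChain : NoInfiniteChain P) where

      ¬stranded : ¬ Stranded A x
      ¬stranded {A} {x} x-stranded =
        noChain (f , strictlyAscending-injective climb-≤ climb-≢ , ascending-comparable climb-≤)
        where
        climb : ℕ → Σ Carrier (Stranded A)
        climb zero    = x , x-stranded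
        climb (suc n) = let y , y-stranded , _ = stranded-ascend (proj₂ (climb n)) in y , y-stranded

        f : ℕ → Carrier
        f n = proj₁ (climb n)

        climb-≤ : ∀ n → f n ≤ f (suc n)
        climb-≤ n = proj₁ (proj₂ (proj₂ (stranded-ascend (proj₂ (climb n)))))

        climb-≢ : ∀ n → f n ≢ f (suc n)
        climb-≢ n = proj₂ (proj₂ (proj₂ (stranded-ascend (proj₂ (climb n)))))

      Max-above : A x → ∃ λ m → Max P A m × x ≤ m
      Max-above x∈A = em⇒dne lem λ no-max → ¬stranded (x∈A , no-max)

      Max-mono : A ⊆ B → _≤₁_ P (Max P A) (Max P B)
      Max-mono A⊆B x (x∈A , _) = Max-above (A⊆B x∈A)

-- Min and ≤₂ in P are, definitionally, Max and ≤₁ in the dual poset.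
Min-antitone : ∀ P → ExcludedMiddle 0ℓ → NoInfiniteChain P →
               ∀ {A B} → B ⊆ A → _≤₂_ P (Min P A) (Min P B)
Min-antitone P lem noChain = Max-mono (dual P) lem (dual-noInfiniteChain P noChain)

module _ (P : BoundedPoset) where
  open BoundedPoset P
  open IsPartialOrder isPartialOrder using () renaming (refl to ≤-refl; trans to ≤-trans)

  private variable
    A A′ B B′ : Subset P
    x y : Carrier

  ⊆⇒≤₁ : A ⊆ B → _≤₁_ P A B
  ⊆⇒≤₁ A⊆B x x∈A = x , A⊆B x∈A , ≤-refl

  ≤₁-refl : ∀ A → _≤₁_ P A A
  ≤₁-refl A x x∈A = x , x∈A , ≤-refl

  ⊇⇒≤₂ : B ⊆ A → _≤₂_ P A B
  ⊇⇒≤₂ B⊆A y y∈B = y , B⊆A y∈B , ≤-refl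

  ｛｝-mono-≤₁ : x ≤ y → _≤₁_ P ｛ x ｝ ｛ y ｝
  ｛｝-mono-≤₁ {y = y} x≤y _ refl = y , refl , x≤y

  ｛｝-mono-≤₂ : x ≤ y → _≤₂_ P ｛ x ｝ ｛ y ｝
  ｛｝-mono-≤₂ {x = x} x≤y _ refl = x , refl , x≤y

  ∪-mono-≤₁ : _≤₁_ P A A′ → _≤₁_ P B B′ → _≤₁_ P (A ∪ B) (A′ ∪ B′)
  ∪-mono-≤₁ A≤A′ _   x (inj₁ x∈A) = let y , y∈A′ , x≤y = A≤A′ x x∈A in y , inj₁ y∈A′ , x≤y
  ∪-mono-≤₁ _   B≤B′ x (inj₂ x∈B) = let y , y∈B′ , x≤y = B≤B′ x x∈B in y , inj₂ y∈B′ , x≤y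

  ∪-mono-≤₂ : _≤₂_ P A A′ → _≤₂_ P B B′ → _≤₂_ P (A ∪ B) (A′ ∪ B′)
  ∪-mono-≤₂ A≤A′ _   y (inj₁ y∈A′) = let x , x∈A , x≤y = A≤A′ y y∈A′ in x , inj₁ x∈A , x≤y
  ∪-mono-≤₂ _   B≤B′ y (inj₂ y∈B′) = let x , x∈B , x≤y = B≤B′ y y∈B′ in x , inj₂ x∈B , x≤y

  L-mono-≤₂ : _≤₂_ P A B → L P A ⊆ L P B
  L-mono-≤₂ A≤B z∈LA w w∈B = let v , v∈A , v≤w = A≤B w w∈B in ≤-trans (z∈LA v v∈A) v≤w

  U-antitone-≤₁ : _≤₁_ P A B → U P B ⊆ U P A
  U-antitone-≤₁ A≤B z∈UB w w∈A = let v , v∈B , w≤v = A≤B w w∈A in ≤-trans w≤v (z∈UB v v∈B)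

  module _ (lem : ExcludedMiddle 0ℓ) (noChain : NoInfiniteChain P) where

    ∘-monotoneLeft : MonotoneLeft P (_∘ₚ_ P)
    ∘-monotoneLeft x y z x≤y = Max-mono P lem noChain
      (L-mono-≤₂ (∪-mono-≤₂ (｛｝-mono-≤₂ x≤y) (｛｝-mono-≤₂ ≤-refl)))

    ⊙-monotoneLeft : MonotoneLeft P (_⊙ₚ_ P)
    ⊙-monotoneLeft x y z x≤y = Max-mono P lem noChain
      (L-mono-≤₂ (∪-mono-≤₂ (｛｝-mono-≤₂ ≤-refl)
        (⊇⇒≤₂ (U-antitone-≤₁ (∪-mono-≤₁ (｛｝-mono-≤₁ x≤y) (≤₁-refl (_⁺ P z)))))))

    ⇒-monotoneRight : MonotoneRight P (_⇒ₚ_ P)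
    ⇒-monotoneRight x y z x≤y = Min-antitone P lem noChain
      (U-antitone-≤₁ (∪-mono-≤₁ (≤₁-refl (_⁺ P z)) (｛｝-mono-≤₁ x≤y)))

    ↪-monotoneRight : MonotoneRight P (_↪ₚ_ P)
    ↪-monotoneRight x y z x≤y = Min-antitone P lem noChain
      (U-antitone-≤₁ (∪-mono-≤₁ (≤₁-refl (_⁺ P z))
        (⊆⇒≤₁ (L-mono-≤₂ (∪-mono-≤₂ (｛｝-mono-≤₂ ≤-refl) (｛｝-mono-≤₂ x≤y))))))

lemma4p3 : ExcludedMiddle 0ℓ → (P : BoundedPoset) → Complemented P → NoInfiniteChain P →
             (MonotoneLeft P (_∘ₚ_ P) × MonotoneLeft P (_⊙ₚ_ P))
           × (MonotoneRight P (_⇒ₚ_ P) × MonotoneRight P (_↪ₚ_ P))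
lemma4p3 lem P _ noChain =
    (∘-monotoneLeft P lem noChain , ⊙-monotoneLeft P lem noChain)
  , (⇒-monotoneRight P lem noChain , ↪-monotoneRight P lem noChain)
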